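{- Let $T$ be an unrooted binary phylogenetic $X$-tree and $f$ a convex character on $T$. The natural partial extension of $f$ to $T$ assigns a state to every vertex of $T$ (i.e. the natural covering extension exists) if and only if $f$ has a unique optimal extension to $T$.
   Context: An unrooted binary phylogenetic $X$-tree: internal vertices of degree 3, leaves bijectively labelled by $X$. A character is a surjective $f:X\to\mathcal{C}$. An extension $h:V(T)\to\mathcal{C}$ agrees with $f$ on $X$; $l_h(T)$ counts edges $\{u,v\}$ with $h(u)\neq h(v)$; $l_f(T)=\min_h l_h(T)$; $h$ is optimal if $l_h(T)=l_f(T)$. $f$ is convex on $T$ if $l_f(T)=|\mathcal{C}|-1$. The natural partial extension of a convex $f$ assigns state $c$ to every vertex of the minimal subtree of $T$ spanning $f^{ -1}(c)$, for each $c$, leaving other vertices unassigned; if it assigns all vertices it is called the natural covering extension. -}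

module Defs where

open import Data.Nat using (ℕ; zero; suc; _∸_; _≤_; _<ᵇ_)
open import Data.Fin using (Fin; toℕ; _≟_)
open import Data.Bool using (Bool; true; false; _∧_; not)
open import Data.List using (List; []; _∷_; length; filterᵇ; allFin; cartesianProduct)
open import Data.List.Membership.Propositional using (_∈_)
open import Data.List.Relation.Unary.Unique.Propositional using (Unique)
open import Data.Product using (Σ; ∃; _×_; _,_; proj₁; proj₂)
open import Relation.Nullary using (¬_)
open import Relation.Nullary.Decidable using (⌊_⌋)
open import Relation.Binary.PropositionalEquality using (_≡_; _≢_)
open import Function using (Injective; Surjective)

Adj : ℕ → Set
Adj n = Fin n → Fin n → Bool

deg : ∀ {n} → Adj n → Fin n → ℕ
deg {n} a v = length (filterᵇ (λ u → a v u) (allFin n))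

-- unordered edges {u,v} counted once via toℕ u < toℕ v
numEdges : ∀ {n} → Adj n → ℕ
numEdges {n} a =
  length (filterᵇ (λ p → a (proj₁ p) (proj₂ p) ∧ (toℕ (proj₁ p) <ᵇ toℕ (proj₂ p)))
                  (cartesianProduct (allFin n) (allFin n)))

data Walk {n : ℕ} (a : Adj n) : Fin n → Fin n → List (Fin n) → Set where
  here : ∀ {v} → Walk a v v (v ∷ [])
  step : ∀ {u w v vs} → a u w ≡ true → Walk a w v vs → Walk a u v (u ∷ vs)

Path : ∀ {n} → Adj n → Fin n → Fin n → List (Fin n) → Set
Path a u v vs = Walk a u v vs × Unique vs

-- Labelling: injective map leaf : X → V; labelled vertices have degree ≤ 1,
-- unlabelled vertices have degree 3 (so leaves are exactly the labelled vertices).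
record BinaryPhyloTree (n m : ℕ) : Set where
  field
    adj       : Adj n
    adj-sym   : ∀ u v → adj u v ≡ adj v u
    adj-irr   : ∀ v → adj v v ≡ false
    nonempty  : 1 ≤ n
    connected : ∀ u v → ∃ λ vs → Walk adj u v vs
    edgeCount : numEdges adj ≡ n ∸ 1
    leaf      : Fin m → Fin n
    leaf-inj  : Injective _≡_ _≡_ leaf
    leaf-deg  : ∀ x → deg adj (leaf x) ≤ 1
    inner-deg : ∀ v → (∀ x → leaf x ≢ v) → deg adj v ≡ 3
open BinaryPhyloTree public

Character : ℕ → ℕ → Set
Character m k = Σ (Fin m → Fin k) (Surjective _≡_ _≡_)

module _ {n m k : ℕ} (T : BinaryPhyloTree n m) (f : Character m k) where

  IsExtension : (Fin n → Fin k) → Set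
  IsExtension h = ∀ x → h (leaf T x) ≡ proj₁ f x

  changes : (Fin n → Fin k) → ℕ
  changes h =
    length (filterᵇ (λ p → adj T (proj₁ p) (proj₂ p)
                           ∧ (toℕ (proj₁ p) <ᵇ toℕ (proj₂ p))
                           ∧ not ⌊ h (proj₁ p) ≟ h (proj₂ p) ⌋)
                    (cartesianProduct (allFin n) (allFin n)))

  IsParsimonyScore : ℕ → Set
  IsParsimonyScore s = (∃ λ h → IsExtension h × changes h ≡ s)
                     × (∀ h → IsExtension h → s ≤ changes h)

  Optimal : (Fin n → Fin k) → Set
  Optimal h = IsExtension h × (∀ h' → IsExtension h' → changes h ≤ changes h')

  Convex : Set
  Convex = IsParsimonyScore (k ∸ 1)

  -- v lies in the minimal subtree of T spanning f⁻¹(c):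
  -- v is on the path between two (possibly equal) leaves in state c.
  InSpan : Fin k → Fin n → Set
  InSpan c v = ∃ λ x → ∃ λ y → proj₁ f x ≡ c × proj₁ f y ≡ c
             × ∃ λ vs → Path (adj T) (leaf T x) (leaf T y) vs × v ∈ vs

  NaturalCovering : Set
  NaturalCovering = ∀ v → ∃ λ c → InSpan c v

  UniqueOptimal : Set
  UniqueOptimal = ∃ λ h → Optimal h × (∀ h' → Optimal h' → ∀ v → h' v ≡ h v)

{-# OPTIONS --safe #-}
module Submission where

open import Defs
open import Data.Bool using (Bool; true; false; _∧_; not)
open import Data.Bool.Properties using (T-≡; ∧-conicalˡ; ∧-conicalʳ; ∧-zeroʳ; not-injective)
open import Data.Empty using (⊥; ⊥-elim)
open import Data.Fin as Fin using (Fin; toℕ; _≟_)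
open import Data.Fin.Properties using (toℕ-injective; toℕ<n; any?; pigeonhole)
open import Data.List using (List; []; _∷_; _++_; length; lookup; filterᵇ; allFin; cartesianProduct)
open import Data.List.Properties using (length-tabulate; length-++; ∷-injectiveˡ; ∷-injectiveʳ)
open import Data.List.Membership.Propositional using (_∈_; _∉_)
open import Data.List.Membership.Propositional.Properties
  using (∈-++⁺ʳ; ∈-lookup; ∈-allFin; ∈-cartesianProduct⁺)
open import Data.List.Relation.Unary.Any using (here; there)
open import Data.List.Relation.Unary.All as All using ([])
open import Data.List.Relation.Unary.All.Properties using (¬Any⇒All¬; All¬⇒¬Any)
open import Data.List.Relation.Unary.AllPairs using ([]; _∷_)
open import Data.List.Relation.Unary.Unique.Propositional using (Unique)
open import Data.List.Relation.Unary.Unique.Propositional.Properties using (allFin⁺; cartesianProduct⁺)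
open import Data.Nat using (ℕ; zero; suc; _+_; _∸_; _≤_; _<_; _<ᵇ_; _<?_; _≤?_; z≤n; s≤s; z<s)
open import Data.Nat.Properties
  using (≤-trans; ≤-reflexive; ≤-pred; m≤n⇒m≤1+n; ≰⇒>; <⇒≱; <-asym; <-cmp; <ᵇ⇒<; <⇒<ᵇ;
         +-suc; +-monoˡ-≤; m≤m+n; m<m+n; ∸-monoʳ-<; module ≤-Reasoning)
open import Data.Product using (∃; ∃₂; _×_; _,_; proj₁; proj₂)
open import Data.Sum using (_⊎_; inj₁; inj₂; [_,_])
open import Function.Base using (id; _∘_)
open import Function.Bundles using (_⇔_; mk⇔; Equivalence)
open import Function.Definitions using (StrictlySurjective)
open import Level using (0ℓ)
open import Relation.Binary using (tri<; tri≈; tri>)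
open import Relation.Binary.PropositionalEquality
  using (_≡_; _≢_; refl; sym; trans; cong; subst; module ≡-Reasoning)
open import Relation.Nullary using (¬_; Dec; yes; no; contradiction; ¬?)
open import Relation.Nullary.Decidable using (⌊_⌋; _×-dec_; _⊎-dec_; isYes≗does; does-⇔)
open import Relation.Unary using (Pred; Decidable)

-- A convex character has an optimal extension with |C| − 1 changes, and every extension with
-- that score has path-closed colour classes: splitting a class that is not path-closed would give
-- one more colour without more changes, whereas a connected graph coloured with s colours has at
-- least s − 1 bichromatic edges. So an optimal extension must take state c on the span of f⁻¹(c),
-- and a natural covering leaves it no freedom.
-- Conversely, let h be the unique optimal extension, v a vertex in no span, c = h v and u₀ a leaf
-- in state c. The vertices of colour c whose path to u₀ runs through v contain no leaf, so walking
-- from v away from u₀ to a leaf leaves this set along an edge towards another colour. Recolouring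
-- the set with that colour removes this change and adds at most the one on the edge from v towards
-- u₀: a second optimal extension, differing from h at v.

module _ {a} {A : Set a} where

  count : (A → Bool) → List A → ℕ
  count P xs = length (filterᵇ P xs)

  count-mono : ∀ {P Q : A → Bool} → (∀ {x} → P x ≡ true → Q x ≡ true) →
               ∀ xs → count P xs ≤ count Q xs
  count-mono P⇒Q [] = z≤n
  count-mono {P} {Q} P⇒Q (x ∷ xs) with P x in px | Q x in qx
  ... | true  | true  = s≤s (count-mono P⇒Q xs)
  ... | true  | false = contradiction (trans (sym (P⇒Q px)) qx) λ ()
  ... | false | true  = m≤n⇒m≤1+n (count-mono P⇒Q xs)
  ... | false | false = count-mono P⇒Q xs

  count-mono-< : ∀ {P Q : A → Bool} → (∀ {x} → P x ≡ true → Q x ≡ true) →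
                 ∀ {x xs} → x ∈ xs → Q x ≡ true → P x ≡ false → count P xs < count Q xs
  count-mono-< {P} {Q} P⇒Q {xs = y ∷ xs} (here refl) qx px rewrite px | qx = s≤s (count-mono P⇒Q xs)
  count-mono-< {P} {Q} P⇒Q {xs = y ∷ xs} (there x∈) qx px with P y in py | Q y in qy
  ... | true  | true  = s≤s (count-mono-< P⇒Q x∈ qx px)
  ... | true  | false = contradiction (trans (sym (P⇒Q py)) qy) λ ()
  ... | false | true  = m≤n⇒m≤1+n (count-mono-< P⇒Q x∈ qx px)
  ... | false | false = count-mono-< P⇒Q x∈ qx px

  count-split : ∀ (P R : A → Bool) xs → count P xs ≤ count R xs + count (λ x → P x ∧ not (R x)) xs
  count-split P R [] = z≤n
  count-split P R (x ∷ xs) with P x | R x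
  ... | true  | true  = s≤s (count-split P R xs)
  ... | true  | false = ≤-trans (s≤s (count-split P R xs)) (≤-reflexive (sym (+-suc (count R xs) _)))
  ... | false | true  = m≤n⇒m≤1+n (count-split P R xs)
  ... | false | false = count-split P R xs

  count-none : ∀ {R : A → Bool} {xs} → (∀ {x} → x ∈ xs → R x ≢ true) → count R xs ≡ 0
  count-none {xs = []} _ = refl
  count-none {R} {xs = x ∷ xs} ¬R with R x in rx
  ... | true  = contradiction rx (¬R (here refl))
  ... | false = count-none (¬R ∘ there)

  count-≤1 : ∀ {R : A → Bool} {xs} → Unique xs →
             (∀ {x y} → R x ≡ true → R y ≡ true → x ≡ y) → count R xs ≤ 1
  count-≤1 {xs = []} _ _ = z≤n
  count-≤1 {R} {xs = x ∷ xs} (x∉xs ∷ u) R-unique with R x in rx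
  ... | true  = s≤s (≤-reflexive (count-none λ y∈ ry → All.lookup x∉xs y∈ (R-unique rx ry)))
  ... | false = count-≤1 u R-unique

  count-pos : ∀ {P : A → Bool} xs → 0 < count P xs → ∃ λ x → P x ≡ true
  count-pos {P} (x ∷ xs) pos with P x in px
  ... | true  = x , px
  ... | false = count-pos xs pos

module _ {A : Set} where

  ++-unique⁻ʳ : ∀ xs {ys : List A} → Unique (xs ++ ys) → Unique ys
  ++-unique⁻ʳ []       u       = u
  ++-unique⁻ʳ (x ∷ xs) (_ ∷ u) = ++-unique⁻ʳ xs u

  ++-unique-disjoint : ∀ xs {ys : List A} {z} → Unique (xs ++ ys) → z ∈ xs → z ∉ ys
  ++-unique-disjoint (x ∷ xs) (x∉ ∷ _) (here refl) z∈ys = All.lookup x∉ (∈-++⁺ʳ xs z∈ys) refl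
  ++-unique-disjoint (x ∷ xs) (_ ∷ u)  (there z∈xs) = ++-unique-disjoint xs u z∈xs

Unique⇒length≤ : ∀ {n} {xs : List (Fin n)} → Unique xs → length xs ≤ n
Unique⇒length≤ {n} {xs} xs-unique with length xs ≤? n
... | yes length≤n = length≤n
... | no  length≰n with pigeonhole (≰⇒> length≰n) (lookup xs)
...   | i , j , i<j , same = contradiction same (lookup-distinct xs-unique i<j)
  where
  lookup-distinct : ∀ {ys : List (Fin n)} → Unique ys → ∀ {i j} → i Fin.< j → lookup ys i ≢ lookup ys j
  lookup-distinct {_ ∷ ys} (y∉ ∷ _) {Fin.zero} {Fin.suc j} _ = All.lookup y∉ (∈-lookup j)
  lookup-distinct {_ ∷ _} (_ ∷ ys-unique) {Fin.suc i} {Fin.suc j} (s≤s i<j) = lookup-distinct ys-unique i<j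

⌊⌋-true⁻ : ∀ {X : Set} (X? : Dec X) → ⌊ X? ⌋ ≡ true → X
⌊⌋-true⁻ (yes x) _ = x

⌊⌋-true⁺ : ∀ {X : Set} (X? : Dec X) → X → ⌊ X? ⌋ ≡ true
⌊⌋-true⁺ (yes _) _ = refl
⌊⌋-true⁺ (no ¬x) x = contradiction x ¬x

⌊⌋-false⁻ : ∀ {X : Set} (X? : Dec X) → ⌊ X? ⌋ ≡ false → ¬ X
⌊⌋-false⁻ (no ¬x) _ = ¬x

⌊⌋-false⁺ : ∀ {X : Set} (X? : Dec X) → ¬ X → ⌊ X? ⌋ ≡ false
⌊⌋-false⁺ (yes x) ¬x = contradiction x ¬x
⌊⌋-false⁺ (no _)  _  = refl

⌊⌋-⇔ : ∀ {X Y : Set} → X ⇔ Y → (X? : Dec X) (Y? : Dec Y) → ⌊ X? ⌋ ≡ ⌊ Y? ⌋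
⌊⌋-⇔ X⇔Y X? Y? = trans (isYes≗does X?) (trans (does-⇔ X⇔Y X? Y?) (sym (isYes≗does Y?)))

Undirected : ∀ {n} → Adj n → Set
Undirected a = ∀ u v → a u v ≡ a v u

Connected : ∀ {n} → Adj n → Set
Connected a = ∀ u v → ∃ λ vs → Walk a u v vs

other-neighbour : ∀ {n} {a : Adj n} {t} → 2 ≤ deg a t →
                  ∀ s → ∃ λ t′ → a t t′ ≡ true × t′ ≢ s
other-neighbour {n} {a} {t} two s with count-pos (allFin n) (≤-pred (begin
  2                                  ≤⟨ two ⟩
  count (a t) (allFin n)             ≤⟨ count-split (a t) is-s (allFin n) ⟩
  count is-s (allFin n) + count others (allFin n)
                                     ≤⟨ +-monoˡ-≤ _ (count-≤1 (allFin⁺ n) is-s-unique) ⟩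
  suc (count others (allFin n))      ∎))
  where
  open ≤-Reasoning
  is-s : Fin n → Bool
  is-s x = ⌊ x ≟ s ⌋
  others : Fin n → Bool
  others x = a t x ∧ not (is-s x)
  is-s-unique : ∀ {x y} → is-s x ≡ true → is-s y ≡ true → x ≡ y
  is-s-unique {x} {y} x≡s y≡s = trans (⌊⌋-true⁻ (x ≟ s) x≡s) (sym (⌊⌋-true⁻ (y ≟ s) y≡s))
... | t′ , other =
  t′ , ∧-conicalˡ _ _ other , ⌊⌋-false⁻ (t′ ≟ s) (not-injective (∧-conicalʳ _ _ other))

module _ {n} {a : Adj n} where
  open import Data.List.Membership.DecPropositional (_≟_ {n}) using (_∈?_)

  walk-start : ∀ {u w L} → Walk a u w L → u ∈ L
  walk-start here       = here refl
  walk-start (step _ _) = here refl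

  walk-head : ∀ {u w L} → Walk a u w L → ∃ λ L′ → L ≡ u ∷ L′
  walk-head here       = _ , refl
  walk-head (step _ _) = _ , refl

  walk-end : ∀ {u w L} → Walk a u w L → w ∈ L
  walk-end here        = here refl
  walk-end (step _ wk) = there (walk-end wk)

  walk-++ : ∀ {u v w L₁ L₂} → Walk a u v L₁ → Walk a v w L₂ → ∃ (Walk a u w)
  walk-++ here        wk₂ = _ , wk₂
  walk-++ (step e wk) wk₂ = _ , step e (proj₂ (walk-++ wk wk₂))

  walk-reverse : Undirected a → ∀ {u w L} → Walk a u w L → ∃ (Walk a w u)
  walk-reverse sym-a here = _ , here
  walk-reverse sym-a (step {u} {v} e wk) =
    walk-++ (proj₂ (walk-reverse sym-a wk)) (step (trans (sym-a v u) e) here)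

  walk-split : ∀ {u w L s} → Walk a u w L → s ∈ L →
               ∃₂ λ P S → Walk a u s P × Walk a s w (s ∷ S) × L ≡ P ++ S
  walk-split here         (here refl) = _ , [] , here , here , refl
  walk-split (step e wk)  (here refl) = _ , _ , here , step e wk , refl
  walk-split (step e wk)  (there s∈)  with walk-split wk s∈
  ... | P , S , wk₁ , wk₂ , refl = _ ∷ P , S , step e wk₁ , wk₂ , refl

  walk-uncons : ∀ {u w L} → Walk a u w L → u ≢ w →
                ∃₂ λ b L′ → a u b ≡ true × Walk a b w L′ × L ≡ u ∷ L′
  walk-uncons here        u≢w = contradiction refl u≢w
  walk-uncons (step e wk) _   = _ , _ , e , wk , refl

  walk-crossing : ∀ {P : Pred (Fin n) 0ℓ} → Decidable P → ∀ {s t L} → Walk a s t L → ¬ P s → P t →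
                  ∃₂ λ q p → a q p ≡ true × ¬ P q × P p × p ∈ L
  walk-crossing P? here ¬Ps Pt = contradiction Pt ¬Ps
  walk-crossing P? (step {w = w} e wk) ¬Ps Pt with P? w
  ... | yes Pw = _ , w , e , ¬Ps , Pw , there (walk-start wk)
  ... | no ¬Pw with walk-crossing P? wk ¬Pw Pt
  ...   | q , p , e′ , ¬Pq , Pp , p∈ = q , p , e′ , ¬Pq , Pp , there p∈

  path-suffix : ∀ {u w L s} → Path a u w L → s ∈ L → ∃ λ S → Path a s w (s ∷ S) × u ∉ S
  path-suffix (wk , L-unique) s∈ with walk-split wk s∈
  ... | P , S , wk₁ , wk₂ , refl =
    S , (wk₂ , ¬Any⇒All¬ S (++-unique-disjoint P L-unique (walk-end wk₁)) ∷ ++-unique⁻ʳ P L-unique)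
      , ++-unique-disjoint P L-unique (walk-start wk₁)

  walk⇒path : ∀ {u w L} → Walk a u w L → ∃ (Path a u w)
  walk⇒path here = _ , here , [] ∷ []
  walk⇒path (step {u} e wk) with walk⇒path wk
  ... | L , p with u ∈? L
  ...   | yes u∈ = _ , proj₁ (proj₂ (path-suffix p u∈))
  ...   | no  u∉ = _ , step e (proj₁ p) , ¬Any⇒All¬ L u∉ ∷ proj₂ p

module _ {n} {a b : Adj n} where

  walk-transfer : (∀ {x y} → a x y ≡ true → ∃ (Walk b x y)) →
                  ∀ {u w L} → Walk a u w L → ∃ (Walk b u w)
  walk-transfer edge here        = _ , here
  walk-transfer edge (step e wk) = walk-++ (proj₂ (edge e)) (proj₂ (walk-transfer edge wk))

pairs : ∀ n → List (Fin n × Fin n)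
pairs n = cartesianProduct (allFin n) (allFin n)

∈-pairs : ∀ {n} (x y : Fin n) → (x , y) ∈ pairs n
∈-pairs x y = ∈-cartesianProduct⁺ (∈-allFin x) (∈-allFin y)

pairs-unique : ∀ n → Unique (pairs n)
pairs-unique n = cartesianProduct⁺ (allFin⁺ n) (allFin⁺ n)

_≐_ : ∀ {n} → Fin n × Fin n → Fin n × Fin n → Set
(x , y) ≐ (u , v) = (x ≡ u × y ≡ v) ⊎ (x ≡ v × y ≡ u)

_≐?_ : ∀ {n} (p q : Fin n × Fin n) → Dec (p ≐ q)
(x , y) ≐? (u , v) = ((x ≟ u) ×-dec (y ≟ v)) ⊎-dec ((x ≟ v) ×-dec (y ≟ u))

≐-swap : ∀ {n} {x y : Fin n} {e} → (x , y) ≐ e → (y , x) ≐ e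
≐-swap (inj₁ (x≡u , y≡v)) = inj₂ (y≡v , x≡u)
≐-swap (inj₂ (x≡v , y≡u)) = inj₁ (y≡u , x≡v)

oriented : ∀ {n} (R : Fin n → Fin n → Set) → (∀ {x y} → R x y → R y x) →
           ∀ {x y} → R x y → x ≢ y → ∃₂ λ x′ y′ → R x′ y′ × toℕ x′ < toℕ y′
oriented R R-sym {x} {y} r x≢y with <-cmp (toℕ x) (toℕ y)
... | tri< x<y _ _ = x , y , r , x<y
... | tri≈ _ x≡y _ = contradiction (toℕ-injective x≡y) x≢y
... | tri> _ _ y<x = y , x , R-sym r , y<x

module _ {n} (a : Adj n) where

  edgePair : Fin n × Fin n → Bool
  edgePair p = a (proj₁ p) (proj₂ p) ∧ (toℕ (proj₁ p) <ᵇ toℕ (proj₂ p))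

  -- Spelled exactly as the filter in Defs.changes, so that changes T f is changesIn (adj T)
  -- by definition.
  bichromatic : ∀ {k} → (Fin n → Fin k) → Fin n × Fin n → Bool
  bichromatic h p = a (proj₁ p) (proj₂ p) ∧ (toℕ (proj₁ p) <ᵇ toℕ (proj₂ p))
                    ∧ not ⌊ h (proj₁ p) ≟ h (proj₂ p) ⌋

  changesIn : ∀ {k} → (Fin n → Fin k) → ℕ
  changesIn h = count (bichromatic h) (pairs n)

  edgePair⁺ : ∀ {x y} → a x y ≡ true → toℕ x < toℕ y → edgePair (x , y) ≡ true
  edgePair⁺ e x<y rewrite e = Equivalence.to T-≡ (<⇒<ᵇ x<y)

  bichromatic⁻ : ∀ {k} (h : Fin n → Fin k) {x y} → bichromatic h (x , y) ≡ true →
                 a x y ≡ true × toℕ x < toℕ y × h x ≢ h y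
  bichromatic⁻ h {x} {y} eq
    with a x y | toℕ x <ᵇ toℕ y | <ᵇ⇒< (toℕ x) (toℕ y) | h x ≟ h y | eq
  ... | true | true | x<y | no hx≢hy | _ = refl , x<y _ , hx≢hy

  bichromatic⁺ : ∀ {k} (h : Fin n → Fin k) {x y} → a x y ≡ true → toℕ x < toℕ y → h x ≢ h y →
                 bichromatic h (x , y) ≡ true
  bichromatic⁺ h {x} {y} e x<y hx≢hy
    rewrite e | Equivalence.to T-≡ (<⇒<ᵇ x<y) | ⌊⌋-false⁺ (h x ≟ h y) hx≢hy = refl

  bichromatic-≡ : ∀ {k} (h : Fin n → Fin k) {x y} → h x ≡ h y → bichromatic h (x , y) ≡ false
  bichromatic-≡ h {x} {y} hx≡hy with a x y | toℕ x <ᵇ toℕ y | h x ≟ h y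
  ... | false | _     | _         = refl
  ... | true  | false | _         = refl
  ... | true  | true  | yes _     = refl
  ... | true  | true  | no hx≢hy  = contradiction hx≡hy hx≢hy

  changes≤numEdges : ∀ {k} (h : Fin n → Fin k) → changesIn h ≤ numEdges a
  changes≤numEdges h = count-mono {Q = edgePair} edge (pairs n)
    where
    edge : ∀ {p} → bichromatic h p ≡ true → edgePair p ≡ true
    edge eq with bichromatic⁻ h eq
    ... | e , x<y , _ = edgePair⁺ e x<y

  Coarser : ∀ {k₁ k₂} → (Fin n → Fin k₁) → (Fin n → Fin k₂) → Set
  Coarser h₁ h₂ = ∀ {x y} → a x y ≡ true → h₂ x ≡ h₂ y → h₁ x ≡ h₁ y

  module _ {k₁ k₂} {h₁ : Fin n → Fin k₁} {h₂ : Fin n → Fin k₂} where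

    bichromatic-mono : Coarser h₁ h₂ → ∀ {p} → bichromatic h₁ p ≡ true → bichromatic h₂ p ≡ true
    bichromatic-mono h₁≼h₂ {x , y} eq with bichromatic⁻ h₁ eq
    ... | e , x<y , h₁x≢h₁y = bichromatic⁺ h₂ e x<y (h₁x≢h₁y ∘ h₁≼h₂ e)

    changes-mono : Coarser h₁ h₂ → changesIn h₁ ≤ changesIn h₂
    changes-mono h₁≼h₂ = count-mono (bichromatic-mono h₁≼h₂) (pairs n)

    private
      witness : Undirected a → ∀ {x y} → a x y ≡ true → h₂ x ≢ h₂ y → h₁ x ≡ h₁ y →
                ∃ λ p → bichromatic h₂ p ≡ true × bichromatic h₁ p ≡ false
      witness sym-a e h₂≢ h₁≡ with oriented Split Split-sym (e , h₂≢ , h₁≡) (h₂≢ ∘ cong h₂)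
        where
        Split : Fin n → Fin n → Set
        Split x y = a x y ≡ true × h₂ x ≢ h₂ y × h₁ x ≡ h₁ y
        Split-sym : ∀ {x y} → Split x y → Split y x
        Split-sym {x} {y} (e , h₂≢ , h₁≡) = trans (sym-a y x) e , h₂≢ ∘ sym , sym h₁≡
      ... | x , y , (e , h₂≢ , h₁≡) , x<y =
        (x , y) , bichromatic⁺ h₂ e x<y h₂≢ , bichromatic-≡ h₁ h₁≡

    changes-mono-< : Undirected a → Coarser h₁ h₂ →
                     ∀ {x y} → a x y ≡ true → h₂ x ≢ h₂ y → h₁ x ≡ h₁ y →
                     changesIn h₁ < changesIn h₂
    changes-mono-< sym-a h₁≼h₂ e h₂≢ h₁≡ with witness sym-a e h₂≢ h₁≡
    ... | (x , y) , b₂ , b₁ = count-mono-< (bichromatic-mono h₁≼h₂) (∈-pairs x y) b₂ b₁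

    changes-≤-exchange : Undirected a → ∀ {u v} →
                         (∀ {x y} → a x y ≡ true → h₂ x ≡ h₂ y → h₁ x ≡ h₁ y ⊎ (x , y) ≐ (u , v)) →
                         ∀ {x y} → a x y ≡ true → h₂ x ≢ h₂ y → h₁ x ≡ h₁ y →
                         changesIn h₁ ≤ changesIn h₂
    changes-≤-exchange sym-a {u} {v} h₁≼h₂ e h₂≢ h₁≡ with witness sym-a e h₂≢ h₁≡
    ... | (x , y) , b₂ , b₁ = begin
      count (bichromatic h₁) E               ≤⟨ count-split (bichromatic h₁) exceptional E ⟩
      count exceptional E + count regular E  ≤⟨ +-monoˡ-≤ _ (count-≤1 (pairs-unique n) exceptional-unique) ⟩
      suc (count regular E)                  ≤⟨ count-mono-< regular⇒bichromatic (∈-pairs x y) b₂ regular-xy ⟩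
      count (bichromatic h₂) E               ∎
      where
      open ≤-Reasoning
      E : List (Fin n × Fin n)
      E = pairs n
      exceptional : Fin n × Fin n → Bool
      exceptional p = ⌊ (toℕ (proj₁ p) <? toℕ (proj₂ p)) ×-dec (p ≐? (u , v)) ⌋
      regular : Fin n × Fin n → Bool
      regular p = bichromatic h₁ p ∧ not (exceptional p)
      exceptional-unique : ∀ {p q} → exceptional p ≡ true → exceptional q ≡ true → p ≡ q
      exceptional-unique {p} {q} ep eq
        with ⌊⌋-true⁻ ((toℕ (proj₁ p) <? toℕ (proj₂ p)) ×-dec (p ≐? (u , v))) ep
           | ⌊⌋-true⁻ ((toℕ (proj₁ q) <? toℕ (proj₂ q)) ×-dec (q ≐? (u , v))) eq
      ... | _ , inj₁ (refl , refl) | _ , inj₁ (refl , refl) = refl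
      ... | _ , inj₂ (refl , refl) | _ , inj₂ (refl , refl) = refl
      ... | u<v , inj₁ (refl , refl) | v<u , inj₂ (refl , refl) = contradiction u<v (<-asym v<u)
      ... | v<u , inj₂ (refl , refl) | u<v , inj₁ (refl , refl) = contradiction u<v (<-asym v<u)
      regular⇒bichromatic : ∀ {p} → regular p ≡ true → bichromatic h₂ p ≡ true
      regular⇒bichromatic {s , t} r with bichromatic⁻ h₁ (∧-conicalˡ _ _ r)
      ... | e , s<t , h₁≢ = bichromatic⁺ h₂ e s<t h₂-differs
        where
        not-exceptional : ¬ (s , t) ≐ (u , v)
        not-exceptional st≐uv =
          ⌊⌋-false⁻ ((toℕ s <? toℕ t) ×-dec ((s , t) ≐? (u , v)))
                    (not-injective (∧-conicalʳ _ _ r)) (s<t , st≐uv)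
        h₂-differs : h₂ s ≢ h₂ t
        h₂-differs h₂≡ = [ h₁≢ , not-exceptional ] (h₁≼h₂ e h₂≡)
      regular-xy : regular (x , y) ≡ false
      regular-xy rewrite b₁ = refl

module _ {X A : Set} {P : Pred X 0ℓ} (P? : Decidable P) where

  paint : A → (X → A) → X → A
  paint c h x with P? x
  ... | yes _ = c
  ... | no  _ = h x

  paint-∈ : ∀ {c h x} → P x → paint c h x ≡ c
  paint-∈ {x = x} Px with P? x
  ... | yes _  = refl
  ... | no ¬Px = contradiction Px ¬Px

  paint-∉ : ∀ {c h x} → ¬ P x → paint c h x ≡ h x
  paint-∉ {x = x} ¬Px with P? x
  ... | yes Px = contradiction Px ¬Px
  ... | no _   = refl

  paint-cong : ∀ {c h x y} → (P x → P y) → (P y → P x) → h x ≡ h y → paint c h x ≡ paint c h y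
  paint-cong {x = x} {y} Px⇒Py Py⇒Px hx≡hy with P? x | P? y
  ... | yes _  | yes _  = refl
  ... | no _   | no _   = hx≡hy
  ... | yes Px | no ¬Py = contradiction (Px⇒Py Px) ¬Py
  ... | no ¬Px | yes Py = contradiction (Py⇒Px Py) ¬Px

module _ {n} {a : Adj n} (sym-a : Undirected a) (conn : Connected a) where

  -- Recolouring the class of c with the colour across an edge leaving it loses one colour and at
  -- least one bichromatic edge.
  colours≤changes+1 : ∀ {k} (h : Fin n → Fin k) (S : List (Fin k)) → Unique S →
                      (∀ {c} → c ∈ S → ∃ λ v → h v ≡ c) → length S ≤ suc (changesIn a h)
  colours≤changes+1 h []          _ _ = z≤n
  colours≤changes+1 h (_ ∷ [])    _ _ = s≤s z≤n
  colours≤changes+1 {k} h (c ∷ d ∷ S) (c∉ ∷ S-unique) used with used (here refl) | used (there (here refl))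
  ... | v₁ , refl | v₂ , refl
    with walk-crossing (λ x → h x ≟ h v₁) (proj₂ (conn v₂ v₁)) (All.lookup c∉ (here refl) ∘ sym) refl
  ... | q , p , e , hq≢c , hp≡c , _ =
    s≤s (≤-trans (colours≤changes+1 h′ (d ∷ S) S-unique used′)
                 (changes-mono-< a sym-a merged e (λ hq≡hp → hq≢c (trans hq≡hp hp≡c))
                                   (trans (paint-∉ has-c? hq≢c) (sym (paint-∈ has-c? hp≡c)))))
    where
    has-c? : Decidable (λ x → h x ≡ h v₁)
    has-c? x = h x ≟ h v₁
    h′ : Fin n → Fin k
    h′ = paint has-c? (h q) h
    merged : Coarser a h′ h
    merged _ hx≡hy = paint-cong has-c? (trans (sym hx≡hy)) (trans hx≡hy) hx≡hy
    used′ : ∀ {e} → e ∈ d ∷ S → ∃ λ v → h′ v ≡ e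
    used′ e∈ with used (there e∈)
    ... | v , refl = v , paint-∉ has-c? (All.lookup c∉ e∈ ∘ sym)

  onto⇒colours≤changes+1 : ∀ {k} (h : Fin n → Fin k) → StrictlySurjective _≡_ h →
                           k ≤ suc (changesIn a h)
  onto⇒colours≤changes+1 {k} h onto =
    subst (_≤ suc (changesIn a h)) (length-tabulate id)
          (colours≤changes+1 h (allFin k) (allFin⁺ k) (λ {c} _ → onto c))

  vertices≤numEdges+1 : n ≤ suc (numEdges a)
  vertices≤numEdges+1 =
    ≤-trans (onto⇒colours≤changes+1 id (λ v → v , refl)) (s≤s (changes≤numEdges a id))

deleteEdge : ∀ {n} → Adj n → Fin n → Fin n → Adj n
deleteEdge a u v x y = a x y ∧ not ⌊ (x , y) ≐? (u , v) ⌋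

module _ {n} {a : Adj n} {u v : Fin n} where

  deleteEdge-undirected : Undirected a → Undirected (deleteEdge a u v)
  deleteEdge-undirected sym-a x y
    rewrite sym-a x y | ⌊⌋-⇔ (mk⇔ ≐-swap ≐-swap) ((x , y) ≐? (u , v)) ((y , x) ≐? (u , v)) = refl

  deleteEdge-⊆ : ∀ {x y} → deleteEdge a u v x y ≡ true → a x y ≡ true
  deleteEdge-⊆ = ∧-conicalˡ _ _

  deleteEdge-keeps : ∀ {x y} → a x y ≡ true → ¬ (x , y) ≐ (u , v) → deleteEdge a u v x y ≡ true
  deleteEdge-keeps {x} {y} e ≉uv rewrite e | ⌊⌋-false⁺ ((x , y) ≐? (u , v)) ≉uv = refl

  walk-avoiding : ∀ {x y L} → Walk a x y L → u ∉ L → Walk (deleteEdge a u v) x y L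
  walk-avoiding here        _   = here
  walk-avoiding (step e wk) u∉ =
    step (deleteEdge-keeps e λ { (inj₁ (refl , _)) → u∉ (here refl)
                               ; (inj₂ (_ , refl)) → u∉ (there (walk-start wk)) })
         (walk-avoiding wk (u∉ ∘ there))

  numEdges-deleteEdge : Undirected a → a u v ≡ true → u ≢ v → numEdges (deleteEdge a u v) < numEdges a
  numEdges-deleteEdge sym-a e u≢v with oriented Deleted Deleted-sym (inj₁ (refl , refl) , e) u≢v
    where
    Deleted : Fin n → Fin n → Set
    Deleted x y = (x , y) ≐ (u , v) × a x y ≡ true
    Deleted-sym : ∀ {x y} → Deleted x y → Deleted y x
    Deleted-sym {x} {y} (≐uv , e) = ≐-swap ≐uv , trans (sym-a y x) e
  ... | x , y , (≐uv , e′) , x<y =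
    count-mono-< kept (∈-pairs x y) (edgePair⁺ a e′ x<y) gone
    where
    kept : ∀ {p} → edgePair (deleteEdge a u v) p ≡ true → edgePair a p ≡ true
    kept r rewrite deleteEdge-⊆ (∧-conicalˡ _ _ r) = ∧-conicalʳ _ _ r
    gone : edgePair (deleteEdge a u v) (x , y) ≡ false
    gone rewrite ⌊⌋-true⁺ ((x , y) ≐? (u , v)) ≐uv | ∧-zeroʳ (a x y) = refl

  deleteEdge-connected : Undirected a → Connected a → ∀ {L} → Walk (deleteEdge a u v) u v L →
                         Connected (deleteEdge a u v)
  deleteEdge-connected sym-a conn detour x y = walk-transfer edge (proj₂ (conn x y))
    where
    edge : ∀ {x y} → a x y ≡ true → ∃ (Walk (deleteEdge a u v) x y)
    edge {x} {y} e with (x , y) ≐? (u , v)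
    ... | yes (inj₁ (refl , refl)) = _ , detour
    ... | yes (inj₂ (refl , refl)) = walk-reverse (deleteEdge-undirected sym-a) detour
    ... | no ≉uv                   = _ , step (deleteEdge-keeps e ≉uv) here

record IsTree {n} (a : Adj n) : Set where
  field
    undirected  : Undirected a
    loopless    : ∀ v → a v v ≡ false
    nonEmpty    : 1 ≤ n
    isConnected : Connected a
    numEdges≡   : numEdges a ≡ n ∸ 1

module Tree {n} {a : Adj n} (tree : IsTree a) where
  open IsTree tree

  adjacent⇒≢ : ∀ {x y} → a x y ≡ true → x ≢ y
  adjacent⇒≢ {x} e refl = contradiction (trans (sym (loopless x)) e) λ ()

  -- Deleting the edge u x would leave the graph connected (via y and w) with only n − 2 edges.
  acyclic : ∀ {u x y w L₁ L₂} → a u x ≡ true → a u y ≡ true → x ≢ y →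
            Walk a x w L₁ → u ∉ L₁ → Walk a y w L₂ → u ∉ L₂ → ⊥
  acyclic {u} {x} {y} ex ey x≢y wk₁ u∉₁ wk₂ u∉₂ = <⇒≱ (∸-monoʳ-< z<s nonEmpty) (begin
    n                               ≤⟨ vertices≤numEdges+1 (deleteEdge-undirected undirected) connected⁻ ⟩
    suc (numEdges (deleteEdge a u x)) ≤⟨ numEdges-deleteEdge undirected ex (adjacent⇒≢ ex) ⟩
    numEdges a                      ≡⟨ numEdges≡ ⟩
    n ∸ 1                           ∎)
    where
    open ≤-Reasoning
    uy-kept : deleteEdge a u x u y ≡ true
    uy-kept = deleteEdge-keeps {a = a} ey λ { (inj₁ (_ , y≡x)) → x≢y (sym y≡x)
                                    ; (inj₂ (u≡x , _)) → adjacent⇒≢ ex u≡x }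
    detour : ∃ (Walk (deleteEdge a u x) u x)
    detour = walk-++ (step uy-kept (walk-avoiding wk₂ u∉₂))
                     (proj₂ (walk-reverse (deleteEdge-undirected undirected) (walk-avoiding wk₁ u∉₁)))
    connected⁻ : Connected (deleteEdge a u x)
    connected⁻ = deleteEdge-connected undirected isConnected (proj₂ detour)

  path-unique : ∀ {u w P₁ P₂} → Path a u w P₁ → Path a u w P₂ → P₁ ≡ P₂
  path-unique (here , _) (here , _) = refl
  path-unique (here , _) (step _ wk , u∉ ∷ _) = contradiction (walk-end wk) (All¬⇒¬Any u∉)
  path-unique (step _ wk , u∉ ∷ _) (here , _) = contradiction (walk-end wk) (All¬⇒¬Any u∉)
  path-unique (step {w = x} e₁ wk₁ , u∉₁ ∷ u₁) (step {w = y} e₂ wk₂ , u∉₂ ∷ u₂) with x ≟ y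
  ... | yes refl = cong (_ ∷_) (path-unique (wk₁ , u₁) (wk₂ , u₂))
  ... | no x≢y   = ⊥-elim (acyclic e₁ e₂ x≢y wk₁ (All¬⇒¬Any u∉₁) wk₂ (All¬⇒¬Any u∉₂))

  open import Data.List.Membership.DecPropositional (_≟_ {n}) using (_∈?_)

  path : Fin n → Fin n → List (Fin n)
  path x y = proj₁ (walk⇒path (proj₂ (isConnected x y)))

  path-isPath : ∀ x y → Path a x y (path x y)
  path-isPath x y = proj₂ (walk⇒path (proj₂ (isConnected x y)))

  path-canonical : ∀ {x y L} → Path a x y L → L ≡ path x y
  path-canonical p = path-unique p (path-isPath _ _)

  path-start : ∀ {x y} → x ∈ path x y
  path-start = walk-start (proj₁ (path-isPath _ _))

  path-self : ∀ x → path x x ≡ x ∷ []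
  path-self x = sym (path-canonical (here , [] ∷ []))

  hop-unique : ∀ {u w x y} → path u w ≡ u ∷ path x w → path u w ≡ u ∷ path y w → x ≡ y
  hop-unique {u} {w} {x} {y} via-x via-y
    with walk-head (proj₁ (path-isPath x w)) | walk-head (proj₁ (path-isPath y w))
  ... | _ , px | _ , py = ∷-injectiveˡ (trans (sym px) (trans (∷-injectiveʳ (trans (sym via-x) via-y)) py))

  path-step : ∀ {x y u} → a x y ≡ true → x ∉ path y u → path x u ≡ x ∷ path y u
  path-step {x} {y} {u} e x∉ with path-isPath y u
  ... | wk , L-unique = sym (path-canonical (step e wk , ¬Any⇒All¬ _ x∉ ∷ L-unique))

  adjacent-paths : ∀ {x y u} → a x y ≡ true → path x u ≡ x ∷ path y u ⊎ path y u ≡ y ∷ path x u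
  adjacent-paths {x} {y} {u} e with x ∈? path y u
  ... | no x∉ = inj₁ (path-step e x∉)
  ... | yes x∈ with path-suffix (path-isPath y u) x∈
  ...   | S , (wk , xS-unique) , y∉S = inj₂ (begin
    path y u      ≡⟨ sym (path-canonical (step (trans (undirected y x) e) wk ,
                                              ¬Any⇒All¬ _ y∉xS ∷ xS-unique)) ⟩
    y ∷ x ∷ S     ≡⟨ cong (y ∷_) (path-canonical (wk , xS-unique)) ⟩
    y ∷ path x u  ∎)
    where
    open ≡-Reasoning
    y∉xS : y ∉ x ∷ S
    y∉xS (here y≡x)  = adjacent⇒≢ e (sym y≡x)
    y∉xS (there y∈S) = y∉S y∈S

  ∈-path-adjacent : ∀ {x y u z} → a x y ≡ true → z ∈ path x u → z ≢ x → z ∈ path y u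
  ∈-path-adjacent e z∈ z≢x with adjacent-paths e
  ... | inj₁ px≡ with subst (_ ∈_) px≡ z∈
  ...   | here z≡x  = contradiction z≡x z≢x
  ...   | there z∈′ = z∈′
  ∈-path-adjacent e z∈ z≢x | inj₂ py≡ = subst (_ ∈_) (sym py≡) (there z∈)

  next-hop : ∀ {u w} → u ≢ w → ∃ λ b → a u b ≡ true × path u w ≡ u ∷ path b w
  next-hop {u} {w} u≢w with path-isPath u w
  ... | wk , L-unique with walk-uncons wk u≢w
  ...   | b , L′ , e , wk′ , L≡ =
    b , e , trans L≡ (cong (u ∷_) (path-canonical (wk′ , tail-unique (subst Unique L≡ L-unique))))
    where
    tail-unique : ∀ {x xs} → Unique (x ∷ xs) → Unique xs
    tail-unique (_ ∷ xs-unique) = xs-unique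

  -- Otherwise, splitting off the part of u's colour class that z separates from u gives one colour
  -- more without more changes.
  monochromatic-path : ∀ {k} (g : Fin n → Fin k) → StrictlySurjective _≡_ g → changesIn a g ≤ k ∸ 1 →
                       ∀ {w u z} → g w ≡ g u → z ∈ path w u → g z ≡ g u
  monochromatic-path {k} g onto few {w} {u} {z} gw≡gu z∈ with g z ≟ g u
  ... | yes gz≡gu = gz≡gu
  ... | no gz≢gu = ⊥-elim (<⇒≱ (∸-monoʳ-< z<s (≤-trans (s≤s z≤n) (toℕ<n (g u)))) (begin
    k               ≤⟨ ≤-pred (onto⇒colours≤changes+1 undirected isConnected h′ onto′) ⟩
    changesIn a h′  ≤⟨ changes-mono a coarser ⟩
    changesIn a g   ≤⟨ few ⟩
    k ∸ 1           ∎))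
    where
    open ≤-Reasoning
    Severed : Fin n → Set
    Severed x = g x ≡ g u × z ∉ path x u
    severed? : Decidable Severed
    severed? x = (g x ≟ g u) ×-dec ¬? (z ∈? path x u)
    h′ : Fin n → Fin (suc k)
    h′ = paint severed? Fin.zero (Fin.suc ∘ g)
    stays-severed : ∀ {x y} → a x y ≡ true → g x ≡ g y → Severed x → Severed y
    stays-severed e gx≡gy (gx≡gu , z∉) =
      gy≡gu , λ z∈y → z∉ (∈-path-adjacent (trans (undirected _ _) e) z∈y
                                           (λ z≡y → gz≢gu (trans (cong g z≡y) gy≡gu)))
      where gy≡gu = trans (sym gx≡gy) gx≡gu
    coarser : Coarser a h′ g
    coarser e gx≡gy = paint-cong severed? (stays-severed e gx≡gy)
                        (stays-severed (trans (undirected _ _) e) (sym gx≡gy)) (cong Fin.suc gx≡gy)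
    onto′ : StrictlySurjective _≡_ h′
    onto′ Fin.zero =
      u , paint-∈ severed? (refl , λ z∈u → gz≢gu (cong g (z∈[u] (subst (z ∈_) (path-self u) z∈u))))
      where
      z∈[u] : z ∈ u ∷ [] → z ≡ u
      z∈[u] (here z≡u) = z≡u
    onto′ (Fin.suc c) with c ≟ g u
    ... | yes refl = w , trans (paint-∉ severed? (λ severed → proj₂ severed z∈)) (cong Fin.suc gw≡gu)
    ... | no c≢gu with onto c
    ...   | v , refl = v , paint-∉ severed? (c≢gu ∘ proj₁)

module PhyloTree {n m} (T : BinaryPhyloTree n m) where

  isTree : IsTree (adj T)
  isTree = record
    { undirected  = adj-sym T
    ; loopless    = adj-irr T
    ; nonEmpty    = nonempty T
    ; isConnected = connected T
    ; numEdges≡   = edgeCount T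
    }

  open Tree isTree public

  inner-other-neighbour : ∀ {t} → (∀ x → leaf T x ≢ t) →
                          ∀ s → ∃ λ t′ → adj T t t′ ≡ true × t′ ≢ s
  inner-other-neighbour inner =
    other-neighbour {a = adj T} (subst (2 ≤_) (sym (inner-deg T _ inner)) (s≤s (s≤s z≤n)))

  leaf-beyond : ∀ {v b} → adj T v b ≡ true → ∃₂ λ x Q → Walk (adj T) (leaf T x) b Q × v ∉ Q
  leaf-beyond {v} {b} e = extend n b (b ∷ []) here path-b≡ (m≤m+n n 1)
    where
    path-b≡ : path b v ≡ b ∷ v ∷ []
    path-b≡ = trans (path-step (trans (adj-sym T b v) e) b∉) (cong (b ∷_) (path-self v))
      where
      b∉ : b ∉ path v v
      b∉ b∈ with subst (b ∈_) (path-self v) b∈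
      ... | here b≡v = adjacent⇒≢ e (sym b≡v)
    -- Walk away from v; every inner vertex has a second neighbour to continue with. The fuel suffices
    -- because the duplicate-free path from t to v has at most n vertices.
    extend : ∀ fuel t Q → Walk (adj T) t b Q → path t v ≡ Q ++ v ∷ [] → n ≤ fuel + length Q →
             ∃₂ λ x Q → Walk (adj T) (leaf T x) b Q × v ∉ Q
    extend fuel t Q wk path≡ bound with subst Unique path≡ (proj₂ (path-isPath t v))
    ... | Qv-unique with fuel | any? (λ x → leaf T x ≟ t)
    ...   | zero     | _ = contradiction (Unique⇒length≤ Qv-unique) (<⇒≱ (begin-strict
      n                     ≤⟨ bound ⟩
      length Q              <⟨ m<m+n (length Q) z<s ⟩
      length Q + 1          ≡⟨ sym (length-++ Q) ⟩
      length (Q ++ v ∷ [])  ∎))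
      where open ≤-Reasoning
    ...   | suc _    | yes (x , refl) = x , Q , wk , λ v∈Q → ++-unique-disjoint Q Qv-unique v∈Q (here refl)
    ...   | suc fuel | no not-leaf
      with next-hop (λ t≡v → ++-unique-disjoint Q Qv-unique (subst (_∈ Q) t≡v (walk-start wk)) (here refl))
    ...     | hop , _ , path-t≡ with inner-other-neighbour (λ x → not-leaf ∘ (x ,_)) hop
    ...       | t′ , e′ , t′≢hop with adjacent-paths e′
    ...         | inj₁ path-t≡′ = contradiction (hop-unique path-t≡′ path-t≡) t′≢hop
    ...         | inj₂ path-t′≡ =
      extend fuel t′ (t′ ∷ Q) (step (trans (adj-sym T t′ t) e′) wk)
             (trans path-t′≡ (cong (t′ ∷_) path≡))
             (subst (n ≤_) (sym (+-suc fuel (length Q))) bound)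

module _ {n m k} (T : BinaryPhyloTree n m) (f : Character m k) where
  open PhyloTree T
  open import Data.List.Membership.DecPropositional (_≟_ {n}) using (_∈?_)

  -- InSpan c v with the canonical path in place of an arbitrary one, which makes it decidable.
  Covered : Fin k → Fin n → Set
  Covered c v = ∃₂ λ x y → proj₁ f x ≡ c × proj₁ f y ≡ c × v ∈ path (leaf T x) (leaf T y)

  covered? : ∀ c v → Dec (Covered c v)
  covered? c v = any? λ x → any? λ y →
    (proj₁ f x ≟ c) ×-dec (proj₁ f y ≟ c) ×-dec (v ∈? path (leaf T x) (leaf T y))

  InSpan⇒Covered : ∀ {c v} → InSpan T f c v → Covered c v
  InSpan⇒Covered {v = v} (x , y , fx≡c , fy≡c , _ , p , v∈) =
    x , y , fx≡c , fy≡c , subst (v ∈_) (path-canonical p) v∈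

  Covered⇒InSpan : ∀ {c v} → Covered c v → InSpan T f c v
  Covered⇒InSpan (x , y , fx≡c , fy≡c , v∈) = x , y , fx≡c , fy≡c , _ , path-isPath _ _ , v∈

  extension-onto : ∀ {h} → IsExtension T f h → StrictlySurjective _≡_ h
  extension-onto ext c with proj₂ f c
  ... | x , fx≡c = leaf T x , trans (ext x) (fx≡c refl)

  forced-colour : ∀ {h c v} → IsExtension T f h → changes T f h ≤ k ∸ 1 → InSpan T f c v → h v ≡ c
  forced-colour {h} ext few span with InSpan⇒Covered span
  ... | x , y , fx≡c , fy≡c , v∈ =
    trans (monochromatic-path h (extension-onto ext) few (trans (ext x) (trans fx≡c (sym hy≡c))) v∈) hy≡c
    where hy≡c = trans (ext y) fy≡c

  covering⇒unique-optimal : Convex T f → NaturalCovering T f → UniqueOptimal T f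
  covering⇒unique-optimal ((h₀ , ext₀ , h₀≡) , h₀-min) covering = h₀ , optimal₀ , unique
    where
    optimal₀ : Optimal T f h₀
    optimal₀ = ext₀ , λ h ext → subst (_≤ changes T f h) (sym h₀≡) (h₀-min h ext)
    unique : ∀ h → Optimal T f h → ∀ v → h v ≡ h₀ v
    unique h (ext , optimal) v with covering v
    ... | c , span = trans (forced-colour ext (subst (changes T f h ≤_) h₀≡ (optimal h₀ ext₀)) span)
                           (sym (forced-colour ext₀ (≤-reflexive h₀≡) span))

  module Uncovered {h} (optimal : Optimal T f h) (v : Fin n) (uncovered : ¬ Covered (h v) v) where

    ext : IsExtension T f h
    ext = proj₁ optimal

    c : Fin k
    c = h v

    x₀ : Fin m
    x₀ = proj₁ (proj₂ f c)

    fx₀≡c : proj₁ f x₀ ≡ c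
    fx₀≡c = proj₂ (proj₂ f c) refl

    u₀ : Fin n
    u₀ = leaf T x₀

    v-inner : ∀ x → leaf T x ≢ v
    v-inner x refl = uncovered (x , x , sym (ext x) , sym (ext x) , subst (v ∈_) (sym (path-self v)) (here refl))

    Behind : Fin n → Set
    Behind x = h x ≡ c × v ∈ path x u₀

    behind? : Decidable Behind
    behind? x = (h x ≟ c) ×-dec (v ∈? path x u₀)

    v-behind : Behind v
    v-behind = refl , path-start

    leaf-not-behind : ∀ y → ¬ Behind (leaf T y)
    leaf-not-behind y (hy≡c , v∈) = uncovered (y , x₀ , trans (sym (ext y)) hy≡c , fx₀≡c , v∈)

    hop : ∃ λ b → adj T v b ≡ true × path v u₀ ≡ v ∷ path b u₀
    hop = next-hop (v-inner x₀ ∘ sym)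

    b₀ : Fin n
    b₀ = proj₁ hop

    behind-closed : ∀ {p q} → adj T p q ≡ true → Behind p → h q ≡ c →
                    Behind q ⊎ (p ≡ v × q ≡ b₀)
    behind-closed {p} {q} e (_ , v∈) hq≡c with v ≟ p
    ... | no v≢p = inj₁ (hq≡c , ∈-path-adjacent e v∈ v≢p)
    ... | yes refl with v ∈? path q u₀
    ...   | yes v∈q = inj₁ (hq≡c , v∈q)
    ...   | no  v∉q = inj₂ (refl , hop-unique (path-step e v∉q) (proj₂ (proj₂ hop)))

    exit : ∃₂ λ p q → adj T p q ≡ true × Behind p × ¬ Behind q × h q ≢ c
    exit with inner-other-neighbour v-inner b₀
    ... | b , e , b≢b₀ with behind? b
    ...   | no ¬behind = v , b , e , v-behind , ¬behind ,
                         λ hb≡c → [ ¬behind , b≢b₀ ∘ proj₂ ] (behind-closed e v-behind hb≡c)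
    ...   | yes behind with leaf-beyond e
    ...     | x , Q , wk , v∉Q with walk-crossing behind? wk (leaf-not-behind x) behind
    ...       | q , p , e′ , ¬behind-q , behind-p , p∈Q =
      p , q , pq , behind-p , ¬behind-q ,
      λ hq≡c → [ ¬behind-q , (λ (p≡v , _) → v∉Q (subst (_∈ Q) p≡v p∈Q)) ]
                 (behind-closed pq behind-p hq≡c)
      where
      pq : adj T p q ≡ true
      pq = trans (adj-sym T p q) e′

    -- Recolouring Behind with the colour across the exit edge makes that edge monochromatic and can
    -- only make the edge v b₀ bichromatic.
    recolouring : ∀ {p q} → adj T p q ≡ true → Behind p → ¬ Behind q → h q ≢ c →
                  ∃ λ h′ → Optimal T f h′ × h′ v ≢ h v
    recolouring {p} {q} pq behind-p ¬behind-q hq≢c =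
      h′ , (h′-extension , λ h″ ext″ → ≤-trans h′≤h (proj₂ optimal h″ ext″)) ,
      hq≢c ∘ trans (sym (paint-∈ behind? v-behind))
      where
      h′ : Fin n → Fin k
      h′ = paint behind? (h q) h
      h′-extension : IsExtension T f h′
      h′-extension y = trans (paint-∉ behind? (leaf-not-behind y)) (ext y)
      exchange : ∀ {x y} → adj T x y ≡ true → h x ≡ h y → h′ x ≡ h′ y ⊎ (x , y) ≐ (v , b₀)
      exchange {x} {y} e hx≡hy = by-cases (behind? x) (behind? y)
        where
        by-cases : Dec (Behind x) → Dec (Behind y) → h′ x ≡ h′ y ⊎ (x , y) ≐ (v , b₀)
        by-cases (yes bx) (yes by) = inj₁ (trans (paint-∈ behind? bx) (sym (paint-∈ behind? by)))
        by-cases (no ¬bx) (no ¬by) =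
          inj₁ (trans (paint-∉ behind? ¬bx) (trans hx≡hy (sym (paint-∉ behind? ¬by))))
        by-cases (yes bx) (no ¬by) with behind-closed e bx (trans (sym hx≡hy) (proj₁ bx))
        ... | inj₁ by           = contradiction by ¬by
        ... | inj₂ (x≡v , y≡b₀) = inj₂ (inj₁ (x≡v , y≡b₀))
        by-cases (no ¬bx) (yes by) with behind-closed (trans (adj-sym T y x) e) by (trans hx≡hy (proj₁ by))
        ... | inj₁ bx           = contradiction bx ¬bx
        ... | inj₂ (y≡v , x≡b₀) = inj₂ (inj₂ (x≡b₀ , y≡v))
      h′≤h : changes T f h′ ≤ changes T f h
      h′≤h = changes-≤-exchange (adj T) (adj-sym T) exchange pq
               (λ hp≡hq → hq≢c (trans (sym hp≡hq) (proj₁ behind-p)))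
               (trans (paint-∈ behind? behind-p) (sym (paint-∉ behind? ¬behind-q)))

    other-optimum : ∃ λ h′ → Optimal T f h′ × h′ v ≢ h v
    other-optimum with exit
    ... | _ , _ , pq , behind-p , ¬behind-q , hq≢c = recolouring pq behind-p ¬behind-q hq≢c

  unique-optimal⇒covering : UniqueOptimal T f → NaturalCovering T f
  unique-optimal⇒covering (h , optimal , unique) v with covered? (h v) v
  ... | yes covered  = h v , Covered⇒InSpan covered
  ... | no uncovered = ⊥-elim (refute (Uncovered.other-optimum optimal v uncovered))
    where
    refute : (∃ λ h′ → Optimal T f h′ × h′ v ≢ h v) → ⊥
    refute (h′ , optimal′ , moved) = moved (unique h′ optimal′ v)

mainTheorem15 : ∀ {n m k : ℕ} (T : BinaryPhyloTree n m) (f : Character m k) →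
    Convex T f → (NaturalCovering T f ⇔ UniqueOptimal T f)
mainTheorem15 T f convex = mk⇔ (covering⇒unique-optimal T f convex) (unique-optimal⇒covering T f)
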